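{- The digraph $G_2[K_1,P_2,K_1]$ (of order $4$) has weak metric dimension $2$, and for every integer $n\geq 4$ and every $1\leq t\leq n-2$, each of the digraphs $G_1[K_1,K_t,K_{n-t-1}]$, $G_2[K_1,K_t,K_{n-t-1}]$, $G_2[K_t,K_{n-t-1},K_1]$ and $G_2[K_1,\overline{K}_{n-2},K_1]$ (each of order $n$) has weak metric dimension $n-2$.
   Context: $\partial(x,y)$ is the length of a shortest directed path from $x$ to $y$, $\tilde\partial(x,y)=(\partial(x,y),\partial(y,x))$. A vertex set $\{w_1,\dots,w_m\}$ is weakly resolving if $(\tilde\partial(w_1,u),\dots,\tilde\partial(w_m,u))\neq(\tilde\partial(w_1,v),\dots,\tilde\partial(w_m,v))$ for all distinct $u,v$; the weak metric dimension is the minimum size of such a set. $K_t$ is the complete digraph on $t$ vertices, $\overline{K}_t$ the digraph on $t$ vertices with no arcs, $P_2$ the digraph on vertices $a,b$ with the single arc $(a,b)$. $G_1$ is the digraph on $\{0,1,2\}$ with arcs $(0,1),(1,2),(2,1),(2,0)$; $G_2$ is the digraph on $\{0,1,2\}$ with arcs $(0,1),(1,0),(1,2),(2,1),(2,0)$. For a digraph $G$ on $\{0,\dots,m-1\}$ and vertex-disjoint digraphs $H_0,\dots,H_{m-1}$, $G[H_0,\dots,H_{m-1}]$ has vertex set $\bigcup V(H_i)$, and for $x\in V(H_i)$, $y\in V(H_j)$, $(x,y)$ is an arc iff either $i=j$ and $(x,y)$ is an arc of $H_i$, or $i\neq j$ and $(i,j)$ is an arc of $G$. -}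

module Defs where

open import Data.Nat using (ℕ; zero; suc; _<_)
open import Data.Fin using (Fin; zero; suc)
open import Data.Product using (Σ; _×_; _,_)
open import Data.Maybe using (Maybe; just; nothing)
open import Data.Empty using (⊥)
open import Data.List using (List; length)
open import Data.List.Membership.Propositional using (_∈_)
open import Data.List.Relation.Unary.Unique.Propositional using (Unique)
open import Relation.Nullary using (¬_)
open import Relation.Binary.PropositionalEquality using (_≡_; _≢_)
open import Function.Bundles using (_⇔_)

record Digraph : Set₁ where
  field
    V   : Set
    Arc : V → V → Set
open Digraph public

data Walk (G : Digraph) : V G → V G → ℕ → Set where
  here : ∀ {x} → Walk G x x 0
  step : ∀ {x y z k} → Arc G x y → Walk G y z k → Walk G x z (suc k)

-- Dist G x y d : ∂(x,y) = d, where nothing encodes ∞ (no directed path).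
-- A shortest walk is a shortest path, so ∂(x,y) = least length of a walk.
Dist : (G : Digraph) → V G → V G → Maybe ℕ → Set
Dist G x y (just d) = Walk G x y d × (∀ k → k < d → ¬ Walk G x y k)
Dist G x y nothing  = ∀ k → ¬ Walk G x y k

-- ∂(x,y) = ∂(x',y')  (Dist is a functional relation, so equality of values
-- is equality of the sets of d satisfying it).
SameDist : (G : Digraph) → V G → V G → V G → V G → Set
SameDist G x y x' y' = ∀ d → Dist G x y d ⇔ Dist G x' y' d

SameTilde : (G : Digraph) → V G → V G → V G → Set
SameTilde G w u v = SameDist G w u w v × SameDist G u w v w

WeaklyResolving : (G : Digraph) → List (V G) → Set
WeaklyResolving G W =
  ∀ u v → u ≢ v → ¬ (∀ w → w ∈ W → SameTilde G w u v)

WeakMetricDim : Digraph → ℕ → Set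
WeakMetricDim G k =
  Σ (List (V G)) (λ W → Unique W × WeaklyResolving G W × length W ≡ k)
  × (∀ (W : List (V G)) → Unique W → WeaklyResolving G W → k Data.Nat.≤ length W)

K : ℕ → Digraph
K t = record { V = Fin t ; Arc = λ x y → x ≢ y }

Kbar : ℕ → Digraph
Kbar t = record { V = Fin t ; Arc = λ _ _ → ⊥ }

P2 : Digraph
P2 = record { V = Fin 2 ; Arc = λ x y → (x ≡ zero) × (y ≡ suc zero) }

data G1Arc : Fin 3 → Fin 3 → Set where
  a01 : G1Arc zero (suc zero)
  a12 : G1Arc (suc zero) (suc (suc zero))
  a21 : G1Arc (suc (suc zero)) (suc zero)
  a20 : G1Arc (suc (suc zero)) zero

G1 : Digraph
G1 = record { V = Fin 3 ; Arc = G1Arc }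

data G2Arc : Fin 3 → Fin 3 → Set where
  a01 : G2Arc zero (suc zero)
  a10 : G2Arc (suc zero) zero
  a12 : G2Arc (suc zero) (suc (suc zero))
  a21 : G2Arc (suc (suc zero)) (suc zero)
  a20 : G2Arc (suc (suc zero)) zero

G2 : Digraph
G2 = record { V = Fin 3 ; Arc = G2Arc }

data LexArc {m : ℕ} (Arc₀ : Fin m → Fin m → Set) (H : Fin m → Digraph)
     : Σ (Fin m) (λ i → V (H i)) → Σ (Fin m) (λ i → V (H i)) → Set where
  inner : ∀ {i x y} → Arc (H i) x y → LexArc Arc₀ H (i , x) (i , y)
  outer : ∀ {i j x y} → i ≢ j → Arc₀ i j → LexArc Arc₀ H (i , x) (j , y)

Lex : {m : ℕ} → (Fin m → Fin m → Set) → (Fin m → Digraph) → Digraph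
Lex {m} A H = record { V = Σ (Fin m) (λ i → V (H i)) ; Arc = LexArc A H }

fam3 : Digraph → Digraph → Digraph → Fin 3 → Digraph
fam3 H₀ H₁ H₂ zero             = H₀
fam3 H₀ H₁ H₂ (suc zero)       = H₁
fam3 H₀ H₁ H₂ (suc (suc zero)) = H₂

G1[_,_,_] : Digraph → Digraph → Digraph → Digraph
G1[ H₀ , H₁ , H₂ ] = Lex (Arc G1) (fam3 H₀ H₁ H₂)

G2[_,_,_] : Digraph → Digraph → Digraph → Digraph
G2[ H₀ , H₁ , H₂ ] = Lex (Arc G2) (fam3 H₀ H₁ H₂)

-- A weakly resolving set W separates each of its members from every other
-- vertex (at distance 0), so the question is which vertices may lie outside W.
-- If all vertices but b and c lie in W, then W resolves as soon as one member
-- separates b from c; in all four digraphs a vertex of the first part does,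
-- since it has arcs into the second part but none into the third.  Conversely,
-- two vertices of the same complete (or arcless) part are exchanged by an
-- automorphism fixing every other vertex; if both were outside W, it would fix
-- W pointwise while preserving all distances, so W would not separate them.
-- Thus a resolving set misses at most one vertex per part, and a direct twin
-- argument shows that the three parts cannot all miss one, so at most two
-- vertices lie outside W.  The small digraph G2[K1,P2,K1] is checked directly.

module Submission where

open import Defs
open import Data.Nat
  using (ℕ; zero; suc; _+_; _∸_; _≤_; _<_; z≤n; s≤s; z<s; <-cmp; NonZero; >-nonZero)
open import Data.Nat.Properties
  using (<-trans; n<1+n; +-monoˡ-≤; m+n∸n≡m; ∸-monoˡ-≤; module ≤-Reasoning)
open import Data.Nat.Tactic.RingSolver using (solve-∀)
open import Data.Fin using (Fin; zero; suc; _≟_)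
open import Data.Fin.Properties using (injective⇒≤; all?)
open import Data.Fin.Permutation.Components using (transpose; transpose-inverse)
open import Data.Product using (Σ; _×_; _,_; proj₁; uncurry)
open import Data.Product.Properties using (≡-dec)
open import Data.Sum using (_⊎_; inj₁; inj₂)
open import Data.Maybe using (just; nothing)
open import Data.Empty using (⊥; ⊥-elim)
open import Data.List using (List; []; _∷_; _++_; length; lookup; filter; tabulate; map)
open import Data.List.Properties using (length-++; length-tabulate; length-map)
open import Data.List.Relation.Unary.All as All using (All; []; _∷_)
open import Data.List.Relation.Unary.All.Properties using (all-filter)
import Data.List.Relation.Unary.Any as Any
open import Data.List.Relation.Unary.Any using (here; there)
open import Data.List.Relation.Unary.Any.Properties using (lookup-index)
open import Data.List.Relation.Unary.Unique.Propositional using (Unique; []; _∷_)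
open import Data.List.Relation.Unary.Unique.Propositional.Properties
  using (filter⁺; allFin⁺; map⁺; ++⁺; drop⁺)
open import Data.List.Relation.Binary.Subset.Propositional using (_⊆_)
open import Data.List.Relation.Binary.Disjoint.Propositional using (Disjoint)
open import Data.List.Membership.Propositional using (_∈_; _∉_)
open import Data.List.Membership.Propositional.Properties
  using (∈-lookup; ∈-++⁺ˡ; ∈-++⁺ʳ; ∈-++⁻; ∈-filter⁺; ∈-allFin; ∈-map⁺; ∈-map⁻)
import Data.List.Membership.DecPropositional as DecMembership
open import Relation.Nullary using (¬_; Dec; yes; no)
open import Relation.Nullary.Decidable
  using (dec-true; dec-false; ¬?; toWitness; _→-dec_; _⊎-dec_)
open import Relation.Binary using (tri<; tri≈; tri>)
open import Relation.Binary.Definitions using (DecidableEquality)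
open import Relation.Binary.PropositionalEquality
open import Function using (_∘_)
open import Function.Bundles using (mk⇔; Equivalence)
open import Function.Construct.Symmetry using (⇔-sym)

-- Distances

Mutual : (G : Digraph) → V G → V G → Set
Mutual G x y = Arc G x y × Arc G y x

module _ {G : Digraph} where

  walk-length-zero : ∀ {x y} → Walk G x y 0 → x ≡ y
  walk-length-zero here = refl

  walk-length-one : ∀ {x y} → Walk G x y 1 → Arc G x y
  walk-length-one (step a here) = a

  dist-refl : ∀ {x} → Dist G x x (just 0)
  dist-refl = here , λ _ ()

  dist-arc : ∀ {x y} → x ≢ y → Arc G x y → Dist G x y (just 1)
  dist-arc x≢y a =
    step a here , λ { zero _ w → x≢y (walk-length-zero w) ; (suc _) (s≤s ()) }

  dist-functional : ∀ {x y d e} → Dist G x y d → Dist G x y e → d ≡ e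
  dist-functional {d = just d} {just e} (w , shortest) (w′ , shortest′) with <-cmp d e
  ... | tri< d<e _ _ = ⊥-elim (shortest′ d d<e w)
  ... | tri≈ _ d≡e _ = cong just d≡e
  ... | tri> _ _ e<d = ⊥-elim (shortest e e<d w′)
  dist-functional {d = just d}  {nothing} (w , _) none  = ⊥-elim (none d w)
  dist-functional {d = nothing} {just e}  none (w′ , _) = ⊥-elim (none e w′)
  dist-functional {d = nothing} {nothing} _ _           = refl

  sameDist-of-common : ∀ {x y x′ y′ d} →
                       Dist G x y d → Dist G x′ y′ d → SameDist G x y x′ y′
  sameDist-of-common D D′ e = mk⇔
    (λ E → subst (Dist G _ _) (dist-functional D E) D′)
    (λ E → subst (Dist G _ _) (dist-functional D′ E) D)

  sameTilde-swap : ∀ {w u v} → SameTilde G w u v → SameTilde G w v u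
  sameTilde-swap (S , T) = (λ d → ⇔-sym (S d)) , (λ d → ⇔-sym (T d))

  sameTilde-mutual : ∀ {w u v} → w ≢ u → w ≢ v →
                     Mutual G w u → Mutual G w v → SameTilde G w u v
  sameTilde-mutual w≢u w≢v (wu , uw) (wv , vw) =
    sameDist-of-common (dist-arc w≢u wu) (dist-arc w≢v wv) ,
    sameDist-of-common (dist-arc (w≢u ∘ sym) uw) (dist-arc (w≢v ∘ sym) vw)

  ¬sameTilde-self : ∀ {u v} → u ≢ v → ¬ SameTilde G u u v
  ¬sameTilde-self u≢v (S , _) =
    u≢v (walk-length-zero (proj₁ (Equivalence.to (S (just 0)) dist-refl)))

  ¬sameTilde-out : ∀ {w u v} → w ≢ u → Arc G w u → ¬ Arc G w v → ¬ SameTilde G w u v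
  ¬sameTilde-out w≢u wu ¬wv (S , _) =
    ¬wv (walk-length-one (proj₁ (Equivalence.to (S (just 1)) (dist-arc w≢u wu))))

  unresolved-twins : ∀ {W u v} → WeaklyResolving G W → u ∉ W → v ∉ W → u ≢ v →
    (∀ w → w ∈ W → w ≢ u → w ≢ v → Mutual G w u × Mutual G w v) → ⊥
  unresolved-twins R u∉W v∉W u≢v adjacent = R _ _ u≢v λ w w∈W →
    let w≢u = λ { refl → u∉W w∈W } ; w≢v = λ { refl → v∉W w∈W }
    in uncurry (sameTilde-mutual w≢u w≢v) (adjacent w w∈W w≢u w≢v)

  resolving-all-but-two : ∀ {W a b c} → (∀ u → u ∈ W ⊎ u ≡ b ⊎ u ≡ c) →
                          a ∈ W → ¬ SameTilde G a b c → WeaklyResolving G W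
  resolving-all-but-two {a = a} covers a∈W b≁c u v u≢v same with covers u | covers v
  ... | inj₁ u∈W         | _                = ¬sameTilde-self u≢v (same u u∈W)
  ... | inj₂ _           | inj₁ v∈W         =
    ¬sameTilde-self (u≢v ∘ sym) (sameTilde-swap (same v v∈W))
  ... | inj₂ (inj₁ refl) | inj₂ (inj₁ refl) = u≢v refl
  ... | inj₂ (inj₂ refl) | inj₂ (inj₂ refl) = u≢v refl
  ... | inj₂ (inj₁ refl) | inj₂ (inj₂ refl) = b≁c (same a a∈W)
  ... | inj₂ (inj₂ refl) | inj₂ (inj₁ refl) = b≁c (sameTilde-swap (same a a∈W))

-- Automorphisms and transpositions

record Automorphism (G : Digraph) : Set where
  field
    to       : V G → V G
    from     : V G → V G
    to-arc   : ∀ {x y} → Arc G x y → Arc G (to x) (to y)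
    from-arc : ∀ {x y} → Arc G x y → Arc G (from x) (from y)
    from-to  : ∀ x → from (to x) ≡ x
    to-from  : ∀ x → to (from x) ≡ x
open Automorphism

inverse : ∀ {G} → Automorphism G → Automorphism G
inverse σ = record
  { to      = from σ      ; from     = to σ
  ; to-arc  = from-arc σ  ; from-arc = to-arc σ
  ; from-to = to-from σ   ; to-from  = from-to σ
  }

module _ {G : Digraph} where

  walk-map : (σ : Automorphism G) → ∀ {x y k} → Walk G x y k → Walk G (to σ x) (to σ y) k
  walk-map σ here       = here
  walk-map σ (step a w) = step (to-arc σ a) (walk-map σ w)

  walk-pull : (σ : Automorphism G) → ∀ {x y k} → Walk G (to σ x) (to σ y) k → Walk G x y k
  walk-pull σ {x} {y} w =
    subst₂ (λ a b → Walk G a b _) (from-to σ x) (from-to σ y) (walk-map (inverse σ) w)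

  dist-map : (σ : Automorphism G) → ∀ {x y} d → Dist G x y d → Dist G (to σ x) (to σ y) d
  dist-map σ (just d) (w , shortest) =
    walk-map σ w , λ k k<d w′ → shortest k k<d (walk-pull σ w′)
  dist-map σ nothing none = λ k w′ → none k (walk-pull σ w′)

  dist-pull : (σ : Automorphism G) → ∀ {x y} d → Dist G (to σ x) (to σ y) d → Dist G x y d
  dist-pull σ {x} {y} d D =
    subst₂ (λ a b → Dist G a b d) (from-to σ x) (from-to σ y) (dist-map (inverse σ) d D)

  sameDist-automorphism : (σ : Automorphism G) → ∀ {x y} → SameDist G x y (to σ x) (to σ y)
  sameDist-automorphism σ d = mk⇔ (dist-map σ d) (dist-pull σ d)

  resolving-fixed⇒all-fixed : ∀ {W} → WeaklyResolving G W → (σ : Automorphism G) →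
                              (∀ w → w ∈ W → to σ w ≡ w) → ∀ u → ¬ u ≢ to σ u
  resolving-fixed⇒all-fixed R σ fixes u u≢σu = R u (to σ u) u≢σu λ w w∈W →
    subst (λ z → SameDist G w u z (to σ u) × SameDist G u w (to σ u) z) (fixes w w∈W)
      (sameDist-automorphism σ , sameDist-automorphism σ)

record Transposition (H : Digraph) (x y : V H) : Set where
  field
    automorphism : Automorphism H
    exchanges    : to automorphism x ≡ y
    fixes-others : ∀ z → z ≢ x → z ≢ y → to automorphism z ≡ z
open Transposition

module _ {n : ℕ} where

  transpose-exchanges : (x y : Fin n) → transpose x y x ≡ y
  transpose-exchanges x y rewrite dec-true (x ≟ x) refl = refl

  transpose-fixes : (x y z : Fin n) → z ≢ x → z ≢ y → transpose x y z ≡ z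
  transpose-fixes x y z z≢x z≢y rewrite dec-false (z ≟ x) z≢x | dec-false (z ≟ y) z≢y =
    refl

  transpose-injective : (x y : Fin n) {p q : Fin n} → transpose x y p ≡ transpose x y q → p ≡ q
  transpose-injective x y {p} {q} e = begin
    p                             ≡⟨ transpose-inverse y x ⟨
    transpose y x (transpose x y p) ≡⟨ cong (transpose y x) e ⟩
    transpose y x (transpose x y q) ≡⟨ transpose-inverse y x ⟩
    q                             ∎
    where open ≡-Reasoning

  transposition-of-Fin : (R : Fin n → Fin n → Set) →
    (∀ {x y p q} → R p q → R (transpose x y p) (transpose x y q)) →
    (x y : Fin n) → Transposition (record { V = Fin n ; Arc = R }) x y
  transposition-of-Fin R transpose-R x y = record
    { automorphism = record
      { to      = transpose x y                   ; from     = transpose y x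
      ; to-arc  = transpose-R                     ; from-arc = transpose-R
      ; from-to = λ _ → transpose-inverse y x     ; to-from  = λ _ → transpose-inverse x y
      }
    ; exchanges    = transpose-exchanges x y
    ; fixes-others = transpose-fixes x y
    }

  K-transposition : (x y : Fin n) → Transposition (K n) x y
  K-transposition = transposition-of-Fin _ λ {x} {y} p≢q → p≢q ∘ transpose-injective x y

  Kbar-transposition : (x y : Fin n) → Transposition (Kbar n) x y
  Kbar-transposition = transposition-of-Fin _ λ ()

  K-mutual : {x y : Fin n} → x ≢ y → Mutual (K n) x y
  K-mutual x≢y = x≢y , x≢y ∘ sym

module _ {m : ℕ} {A : Fin m → Fin m → Set} {H : Fin m → Digraph} where

  within : ∀ {i} {x y : V (H i)} → Mutual (H i) x y → Mutual (Lex A H) (i , x) (i , y)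
  within (xy , yx) = inner xy , inner yx

  across : ∀ {i j x y} → i ≢ j → A i j → A j i → Mutual (Lex A H) (i , x) (j , y)
  across i≢j aᵢⱼ aⱼᵢ = outer i≢j aᵢⱼ , outer (i≢j ∘ sym) aⱼᵢ

  module _ (k : Fin m) where

    private
      on-part : (V (H k) → V (H k)) → ∀ {i} → Dec (i ≡ k) → V (H i) → V (H i)
      on-part f (yes refl) x = f x
      on-part f (no _)     x = x

      on-part-arc : ∀ {f} → (∀ {x y} → Arc (H k) x y → Arc (H k) (f x) (f y)) →
                    ∀ {i} (i≟k : Dec (i ≡ k)) {x y} → Arc (H i) x y →
                    Arc (H i) (on-part f i≟k x) (on-part f i≟k y)
      on-part-arc f-arc (yes refl) a = f-arc a
      on-part-arc f-arc (no _)     a = a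

      on-part-inverse : ∀ {f g} → (∀ x → g (f x) ≡ x) → ∀ {i} (i≟k : Dec (i ≡ k)) x →
                        on-part g i≟k (on-part f i≟k x) ≡ x
      on-part-inverse g∘f≗id (yes refl) x = g∘f≗id x
      on-part-inverse g∘f≗id (no _)     x = refl

      lift : (V (H k) → V (H k)) → V (Lex A H) → V (Lex A H)
      lift f (i , x) = i , on-part f (i ≟ k) x

      lift-arc : ∀ {f} → (∀ {x y} → Arc (H k) x y → Arc (H k) (f x) (f y)) →
                 ∀ {p q} → Arc (Lex A H) p q → Arc (Lex A H) (lift f p) (lift f q)
      lift-arc f-arc (inner {i} a)  = inner (on-part-arc f-arc (i ≟ k) a)
      lift-arc f-arc (outer i≢j a) = outer i≢j a

      lift-inverse : ∀ {f g} → (∀ x → g (f x) ≡ x) → ∀ p → lift g (lift f p) ≡ p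
      lift-inverse g∘f≗id (i , x) = cong (i ,_) (on-part-inverse g∘f≗id (i ≟ k) x)

    lift-automorphism : Automorphism (H k) → Automorphism (Lex A H)
    lift-automorphism σ = record
      { to      = lift (to σ)               ; from     = lift (from σ)
      ; to-arc  = lift-arc (to-arc σ)       ; from-arc = lift-arc (from-arc σ)
      ; from-to = lift-inverse (from-to σ)  ; to-from  = lift-inverse (to-from σ)
      }

    same-part-outside : ∀ {W x y} → WeaklyResolving (Lex A H) W → Transposition (H k) x y →
                        (k , x) ∉ W → (k , y) ∉ W → ¬ (k , x) ≢ (k , y)
    same-part-outside {W} {x} {y} R τ x∉W y∉W =
      resolving-fixed⇒all-fixed R σ fixes (k , x) ∘ subst ((k , x) ≢_) (sym moves)
      where
      σ = lift-automorphism (automorphism τ)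
      fixes : ∀ w → w ∈ W → to σ w ≡ w
      fixes (i , z) z∈W with i ≟ k
      ... | no _     = refl
      ... | yes refl =
        cong (k ,_) (fixes-others τ z (λ { refl → x∉W z∈W }) (λ { refl → y∉W z∈W }))
      moves : to σ (k , x) ≡ (k , y)
      moves with k ≟ k
      ... | yes refl = cong (k ,_) (exchanges τ)
      ... | no k≢k   = ⊥-elim (k≢k refl)

-- Counting the vertices outside a resolving set

module _ {X : Set} where

  lookup-injective : ∀ {xs : List X} → Unique xs →
                     ∀ {i j} → lookup xs i ≡ lookup xs j → i ≡ j
  lookup-injective (_   ∷ _) {zero}  {zero}  _ = refl
  lookup-injective (x∉ ∷ _) {zero}  {suc j} e = ⊥-elim (All.lookup x∉ (∈-lookup j) e)
  lookup-injective (x∉ ∷ _) {suc i} {zero}  e = ⊥-elim (All.lookup x∉ (∈-lookup i) (sym e))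
  lookup-injective (_   ∷ u) {suc i} {suc j} e = cong suc (lookup-injective u e)

  Unique⇒length-≤ : ∀ {xs ys : List X} → Unique xs → xs ⊆ ys → length xs ≤ length ys
  Unique⇒length-≤ {xs} {ys} unique xs⊆ys = injective⇒≤ {f = position} position-injective
    where
    position : Fin (length xs) → Fin (length ys)
    position i = Any.index (xs⊆ys (∈-lookup i))
    position-injective : ∀ {i j} → position i ≡ position j → i ≡ j
    position-injective {i} {j} e = lookup-injective unique (begin
      lookup xs i            ≡⟨ lookup-index (xs⊆ys (∈-lookup i)) ⟩
      lookup ys (position i) ≡⟨ cong (lookup ys) e ⟩
      lookup ys (position j) ≡⟨ lookup-index (xs⊆ys (∈-lookup j)) ⟨
      lookup xs j            ∎)
      where open ≡-Reasoning

  AtMostTwoOutside : List X → Set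
  AtMostTwoOutside W =
    ∀ {u v w} → u ≢ v → u ≢ w → v ≢ w → u ∉ W → v ∉ W → w ∉ W → ⊥

  Unique⇒length-≤-2+ : DecidableEquality X → ∀ {xs W : List X} →
                       Unique xs → AtMostTwoOutside W → length xs ≤ 2 + length W
  Unique⇒length-≤-2+ _≟ₓ_ {xs} {W} unique two = begin
    length xs                 ≤⟨ Unique⇒length-≤ unique split ⟩
    length (outside ++ W)     ≡⟨ length-++ outside ⟩
    length outside + length W ≤⟨ +-monoˡ-≤ (length W)
                                   (short (filter⁺ outside? unique) (all-filter outside? xs)) ⟩
    2 + length W              ∎
    where
    open ≤-Reasoning
    open DecMembership _≟ₓ_ using (_∈?_)
    outside? = λ x → ¬? (x ∈? W)
    outside  = filter outside? xs
    split : xs ⊆ outside ++ W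
    split {x} x∈xs with x ∈? W
    ... | yes x∈W = ∈-++⁺ʳ outside x∈W
    ... | no  x∉W = ∈-++⁺ˡ (∈-filter⁺ outside? x∈xs x∉W)
    short : ∀ {ys} → Unique ys → All (_∉ W) ys → length ys ≤ 2
    short {[]}          _ _ = z≤n
    short {_ ∷ []}      _ _ = s≤s z≤n
    short {_ ∷ _ ∷ []}  _ _ = s≤s (s≤s z≤n)
    short {_ ∷ _ ∷ _ ∷ _} ((u≢v ∷ u≢w ∷ _) ∷ (v≢w ∷ _) ∷ _) (u∉ ∷ v∉ ∷ w∉ ∷ _) =
      ⊥-elim (two u≢v u≢w v≢w u∉ v∉ w∉)

Fin3-distinct-cover : (i j k l : Fin 3) → i ≢ j → i ≢ k → j ≢ k →
                      l ≡ i ⊎ l ≡ j ⊎ l ≡ k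
Fin3-distinct-cover = toWitness {a? = all? λ i → all? λ j → all? λ k → all? λ l →
  ¬? (i ≟ j) →-dec ¬? (i ≟ k) →-dec ¬? (j ≟ k) →-dec (l ≟ i ⊎-dec l ≟ j ⊎-dec l ≟ k)} _

MissesEveryPart : (H : Fin 3 → Digraph) → List (Σ (Fin 3) λ i → V (H i)) → Set
MissesEveryPart H W = ∀ i → Σ (V (H i)) λ x → (i , x) ∉ W

module _ {A : Fin 3 → Fin 3 → Set} {H : Fin 3 → Digraph}
         (transpositions : ∀ i (x y : V (H i)) → Transposition (H i) x y) where

  at-most-two-outside : ∀ {W} → WeaklyResolving (Lex A H) W →
                        ¬ MissesEveryPart H W → AtMostTwoOutside W
  at-most-two-outside {W} R ¬misses {i , x} {j , y} {k , z} u≢v u≢w v≢w u∉W v∉W w∉W =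
    ¬misses λ l → outside-in l (Fin3-distinct-cover i j k l
      (parts-differ u≢v u∉W v∉W) (parts-differ u≢w u∉W w∉W) (parts-differ v≢w v∉W w∉W))
    where
    parts-differ : ∀ {i j x y} → (i , x) ≢ (j , y) → (i , x) ∉ W → (j , y) ∉ W → i ≢ j
    parts-differ p≢q p∉W q∉W refl =
      same-part-outside _ R (transpositions _ _ _) p∉W q∉W p≢q
    outside-in : ∀ l → l ≡ i ⊎ l ≡ j ⊎ l ≡ k → Σ (V (H l)) λ x → (l , x) ∉ W
    outside-in _ (inj₁ refl)        = x , u∉W
    outside-in _ (inj₂ (inj₁ refl)) = y , v∉W
    outside-in _ (inj₂ (inj₂ refl)) = z , w∉W

-- Compositions of three parts

record Enumeration (X : Set) : Set where
  field
    first    : X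
    rest     : List X
    unique   : Unique (first ∷ rest)
    complete : ∀ x → x ∈ first ∷ rest

  size : ℕ
  size = suc (length rest)
open Enumeration

Fin-enumeration : ∀ n → .{{NonZero n}} → Enumeration (Fin n)
Fin-enumeration (suc n) = record
  { first = zero ; rest = tabulate suc ; unique = allFin⁺ (suc n) ; complete = ∈-allFin }

Fin-size : ∀ n → .{{_ : NonZero n}} → size (Fin-enumeration n) ≡ n
Fin-size (suc n) = cong suc (length-tabulate suc)

module _ {A : Fin 3 → Fin 3 → Set} {H : Fin 3 → Digraph} where

  inPart : (i : Fin 3) → List (V (H i)) → List (V (Lex A H))
  inPart i = map (i ,_)

  layered : List (V (H zero)) → List (V (H (suc zero))) → List (V (H (suc (suc zero)))) →
            List (V (Lex A H))
  layered xs ys zs = inPart zero xs ++ inPart (suc zero) ys ++ inPart (suc (suc zero)) zs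

  module Layered (xs : List (V (H zero))) (ys : List (V (H (suc zero))))
                 (zs : List (V (H (suc (suc zero))))) where

    ∈-layered₀ : ∀ {x} → x ∈ xs → (zero , x) ∈ layered xs ys zs
    ∈-layered₀ x∈xs = ∈-++⁺ˡ (∈-map⁺ _ x∈xs)

    ∈-layered₁ : ∀ {y} → y ∈ ys → (suc zero , y) ∈ layered xs ys zs
    ∈-layered₁ y∈ys = ∈-++⁺ʳ (inPart zero xs) (∈-++⁺ˡ (∈-map⁺ _ y∈ys))

    ∈-layered₂ : ∀ {z} → z ∈ zs → (suc (suc zero) , z) ∈ layered xs ys zs
    ∈-layered₂ z∈zs =
      ∈-++⁺ʳ (inPart zero xs) (∈-++⁺ʳ (inPart (suc zero) ys) (∈-map⁺ _ z∈zs))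

    length-layered : length (layered xs ys zs) ≡ length xs + (length ys + length zs)
    length-layered = begin
      length (layered xs ys zs)
        ≡⟨ length-++ (map _ xs) ⟩
      length (map _ xs) + length (map _ ys ++ map _ zs)
        ≡⟨ cong₂ _+_ (length-map _ xs) (length-++ (map _ ys)) ⟩
      length xs + (length (map _ ys) + length (map _ zs))
        ≡⟨ cong (length xs +_) (cong₂ _+_ (length-map _ ys) (length-map _ zs)) ⟩
      length xs + (length ys + length zs) ∎
      where open ≡-Reasoning

    layered-unique : Unique xs → Unique ys → Unique zs → Unique (layered xs ys zs)
    layered-unique xs! ys! zs! =
      ++⁺ (map⁺ ,-injective xs!)
          (++⁺ (map⁺ ,-injective ys!) (map⁺ ,-injective zs!) disjoint₁₂)
          disjoint₀
      where
      ,-injective : ∀ {i} {x y : V (H i)} → _≡_ {A = V (Lex A H)} (i , x) (i , y) → x ≡ y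
      ,-injective refl = refl
      part-of : ∀ {i} {ws : List (V (H i))} {p} → p ∈ inPart i ws → proj₁ p ≡ i
      part-of {i} p∈ with ∈-map⁻ (i ,_) p∈
      ... | _ , _ , refl = refl
      disjoint₁₂ : Disjoint (inPart (suc zero) ys) (inPart (suc (suc zero)) zs)
      disjoint₁₂ (p∈ys , p∈zs) with trans (sym (part-of p∈ys)) (part-of p∈zs)
      ... | ()
      disjoint₀ : Disjoint (inPart zero xs) (inPart (suc zero) ys ++ inPart (suc (suc zero)) zs)
      disjoint₀ (p∈xs , p∈yzs) with ∈-++⁻ (inPart (suc zero) ys) p∈yzs
      ... | inj₁ p∈ys with trans (sym (part-of p∈xs)) (part-of p∈ys)
      ...   | ()
      disjoint₀ (p∈xs , p∈yzs) | inj₂ p∈zs with trans (sym (part-of p∈xs)) (part-of p∈zs)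
      ...   | ()

  module ThreeParts (enum : ∀ i → Enumeration (V (H i))) where

    private
      e₀ = enum zero
      e₁ = enum (suc zero)
      e₂ = enum (suc (suc zero))
      module Vertices = Layered (first e₀ ∷ rest e₀) (first e₁ ∷ rest e₁) (first e₂ ∷ rest e₂)
      module Basis    = Layered (first e₀ ∷ rest e₀) (rest e₁) (rest e₂)

    order : ℕ
    order = size e₀ + (size e₁ + size e₂)

    basis : List (V (Lex A H))
    basis = layered (first e₀ ∷ rest e₀) (rest e₁) (rest e₂)

    order≡2+length-basis : order ≡ 2 + length basis
    order≡2+length-basis =
      trans (shift (size e₀) (length (rest e₁)) (length (rest e₂)))
            (cong (2 +_) (sym Basis.length-layered))
      where
      shift : ∀ a b c → a + (suc b + suc c) ≡ 2 + (a + (b + c))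
      shift = solve-∀

    basis-covers-all-but-two :
      ∀ u → u ∈ basis ⊎ u ≡ (suc zero , first e₁) ⊎ u ≡ (suc (suc zero) , first e₂)
    basis-covers-all-but-two (zero , x) = inj₁ (Basis.∈-layered₀ (complete e₀ x))
    basis-covers-all-but-two (suc zero , y) with complete e₁ y
    ... | here refl = inj₂ (inj₁ refl)
    ... | there y∈  = inj₁ (Basis.∈-layered₁ y∈)
    basis-covers-all-but-two (suc (suc zero) , z) with complete e₂ z
    ... | here refl = inj₂ (inj₂ refl)
    ... | there z∈  = inj₁ (Basis.∈-layered₂ z∈)

    order∸2≤length-resolving : (∀ i → DecidableEquality (V (H i))) →
      (∀ i (x y : V (H i)) → Transposition (H i) x y) →
      ∀ {W} → WeaklyResolving (Lex A H) W → ¬ MissesEveryPart H W → order ∸ 2 ≤ length W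
    order∸2≤length-resolving _≟ᵢ_ transpositions {W} R ¬misses =
      ∸-monoˡ-≤ 2 (subst (_≤ 2 + length W) Vertices.length-layered
        (Unique⇒length-≤-2+ (≡-dec _≟_ λ {i} → _≟ᵢ_ i)
          (Vertices.layered-unique (unique e₀) (unique e₁) (unique e₂))
          (at-most-two-outside transpositions R ¬misses)))

    weakMetricDim-order∸2 : A zero (suc zero) → ¬ A zero (suc (suc zero)) →
      (∀ W → WeaklyResolving (Lex A H) W → order ∸ 2 ≤ length W) →
      WeakMetricDim (Lex A H) (order ∸ 2)
    weakMetricDim-order∸2 a₀₁ ¬a₀₂ lower =
      ( basis
      , Basis.layered-unique (unique e₀) (drop⁺ 1 (unique e₁)) (drop⁺ 1 (unique e₂))
      , resolving-all-but-two basis-covers-all-but-two (Basis.∈-layered₀ (here refl)) separates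
      , sym (cong (_∸ 2) order≡2+length-basis))
      , λ W _ → lower W
      where
      separates : ¬ SameTilde (Lex A H)
        (zero , first e₀) (suc zero , first e₁) (suc (suc zero) , first e₂)
      separates = ¬sameTilde-out (λ ()) (outer (λ ()) a₀₁) λ { (outer _ a₀₂) → ¬a₀₂ a₀₂ }

fam3-all : (P : Digraph → Set) {H₀ H₁ H₂ : Digraph} → P H₀ → P H₁ → P H₂ →
           ∀ i → P (fam3 H₀ H₁ H₂ i)
fam3-all P p₀ p₁ p₂ zero             = p₀
fam3-all P p₀ p₁ p₂ (suc zero)       = p₁
fam3-all P p₀ p₁ p₂ (suc (suc zero)) = p₂

module _ {H₀ H₁ H₂ : Digraph} where

  fam3-enumeration : Enumeration (V H₀) → Enumeration (V H₁) → Enumeration (V H₂) →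
                     ∀ i → Enumeration (V (fam3 H₀ H₁ H₂ i))
  fam3-enumeration = fam3-all (λ H → Enumeration (V H))

  fam3-≟ : DecidableEquality (V H₀) → DecidableEquality (V H₁) → DecidableEquality (V H₂) →
           ∀ i → DecidableEquality (V (fam3 H₀ H₁ H₂ i))
  fam3-≟ = fam3-all (λ H → DecidableEquality (V H))

  fam3-transpositions : (∀ x y → Transposition H₀ x y) → (∀ x y → Transposition H₁ x y) →
    (∀ x y → Transposition H₂ x y) → ∀ i x y → Transposition (fam3 H₀ H₁ H₂ i) x y
  fam3-transpositions = fam3-all (λ H → ∀ x y → Transposition H x y)

-- The four families

module _ {A : Fin 3 → Fin 3 → Set}
         (a₀₁ : A zero (suc zero)) (a₁₂ : A (suc zero) (suc (suc zero)))
         (a₂₁ : A (suc (suc zero)) (suc zero)) (¬a₀₂ : ¬ A zero (suc (suc zero)))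
         (t s : ℕ) .{{_ : NonZero t}} .{{_ : NonZero s}} where

  private
    H = fam3 (K 1) (K t) (K s)
    open ThreeParts {A = A} {H = H}
      (fam3-enumeration (Fin-enumeration 1) (Fin-enumeration t) (Fin-enumeration s))

    ¬misses : ∀ {W} → WeaklyResolving (Lex A H) W → ¬ MissesEveryPart H W
    ¬misses R misses with misses zero | misses (suc zero) | misses (suc (suc zero))
    ... | zero , a∉W | _ , u∉W | _ , v∉W = unresolved-twins R u∉W v∉W (λ ()) λ where
      (zero , zero) w∈W _ _ → ⊥-elim (a∉W w∈W)
      (suc zero , _) _ w≢u _ → within (K-mutual (w≢u ∘ cong _)) , across (λ ()) a₁₂ a₂₁
      (suc (suc zero) , _) _ _ w≢v → across (λ ()) a₂₁ a₁₂ , within (K-mutual (w≢v ∘ cong _))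

  weakMetricDim-K1-Kt-Ks : WeakMetricDim (Lex A (fam3 (K 1) (K t) (K s))) (t + s ∸ 1)
  weakMetricDim-K1-Kt-Ks =
    subst (WeakMetricDim _) (cong (λ a → a ∸ 1) (cong₂ _+_ (Fin-size t) (Fin-size s)))
      (weakMetricDim-order∸2 a₀₁ ¬a₀₂ λ W R →
        order∸2≤length-resolving (fam3-≟ {K 1} {K t} {K s} _≟_ _≟_ _≟_)
          (fam3-transpositions K-transposition K-transposition K-transposition) R (¬misses R))

module _ (t s : ℕ) .{{_ : NonZero t}} .{{_ : NonZero s}} where

  private
    H = fam3 (K t) (K s) (K 1)
    open ThreeParts {A = G2Arc} {H = H}
      (fam3-enumeration (Fin-enumeration t) (Fin-enumeration s) (Fin-enumeration 1))

    ¬misses : ∀ {W} → WeaklyResolving G2[ K t , K s , K 1 ] W → ¬ MissesEveryPart H W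
    ¬misses R misses with misses zero | misses (suc zero) | misses (suc (suc zero))
    ... | _ , u∉W | _ , v∉W | zero , c∉W = unresolved-twins R u∉W v∉W (λ ()) λ where
      (zero , _) _ w≢u _ → within (K-mutual (w≢u ∘ cong _)) , across (λ ()) a01 a10
      (suc zero , _) _ _ w≢v → across (λ ()) a10 a01 , within (K-mutual (w≢v ∘ cong _))
      (suc (suc zero) , zero) w∈W _ _ → ⊥-elim (c∉W w∈W)

    order≡ : order ≡ 1 + (t + s)
    order≡ = trans (cong₂ (λ a b → a + (b + 1)) (Fin-size t) (Fin-size s)) (shift t s)
      where
      shift : ∀ a b → a + (b + 1) ≡ 1 + (a + b)
      shift = solve-∀

  weakMetricDim-G2[Kt,Ks,K1] : WeakMetricDim G2[ K t , K s , K 1 ] (t + s ∸ 1)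
  weakMetricDim-G2[Kt,Ks,K1] =
    subst (WeakMetricDim _) (cong (_∸ 2) order≡)
      (weakMetricDim-order∸2 a01 (λ ()) λ W R →
        order∸2≤length-resolving (fam3-≟ {K t} {K s} {K 1} _≟_ _≟_ _≟_)
          (fam3-transpositions K-transposition K-transposition K-transposition) R (¬misses R))

module _ (m : ℕ) .{{_ : NonZero m}} where

  private
    H = fam3 (K 1) (Kbar m) (K 1)
    open ThreeParts {A = G2Arc} {H = H}
      (fam3-enumeration (Fin-enumeration 1) (Fin-enumeration m) (Fin-enumeration 1))

    ¬misses : ∀ {W} → WeaklyResolving G2[ K 1 , Kbar m , K 1 ] W → ¬ MissesEveryPart H W
    ¬misses R misses with misses zero | misses (suc (suc zero))
    ... | zero , a∉W | zero , c∉W = unresolved-twins R a∉W c∉W (λ ()) λ where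
      (zero , zero) w∈W _ _ → ⊥-elim (a∉W w∈W)
      (suc zero , _) _ _ _ → across (λ ()) a10 a01 , across (λ ()) a12 a21
      (suc (suc zero) , zero) w∈W _ _ → ⊥-elim (c∉W w∈W)

  weakMetricDim-G2[K1,Kbar,K1] : WeakMetricDim G2[ K 1 , Kbar m , K 1 ] m
  weakMetricDim-G2[K1,Kbar,K1] =
    subst (WeakMetricDim _) (trans (cong (λ a → a + 1 ∸ 1) (Fin-size m)) (m+n∸n≡m m 1))
      (weakMetricDim-order∸2 a01 (λ ()) λ W R →
        order∸2≤length-resolving (fam3-≟ {K 1} {Kbar m} {K 1} _≟_ _≟_ _≟_)
          (fam3-transpositions K-transposition Kbar-transposition K-transposition) R (¬misses R))

weakMetricDim-G2[K1,P2,K1] : WeakMetricDim G2[ K 1 , P2 , K 1 ] 2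
weakMetricDim-G2[K1,P2,K1] = weakMetricDim-order∸2 a01 (λ ()) lower
  where
  G = G2[ K 1 , P2 , K 1 ]
  open ThreeParts {A = G2Arc} {H = fam3 (K 1) P2 (K 1)}
    (fam3-enumeration (Fin-enumeration 1) (Fin-enumeration 2) (Fin-enumeration 1))
  unresolved-by : ∀ z → Σ (V G) λ u → Σ (V G) λ v → u ≢ v × SameTilde G z u v
  unresolved-by (zero , zero) = (suc zero , zero) , (suc zero , suc zero) , (λ ()) ,
    sameTilde-mutual (λ ()) (λ ()) (across (λ ()) a01 a10) (across (λ ()) a01 a10)
  unresolved-by (suc zero , _) = (zero , zero) , (suc (suc zero) , zero) , (λ ()) ,
    sameTilde-mutual (λ ()) (λ ()) (across (λ ()) a10 a01) (across (λ ()) a12 a21)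
  unresolved-by (suc (suc zero) , zero) = (suc zero , zero) , (suc zero , suc zero) , (λ ()) ,
    sameTilde-mutual (λ ()) (λ ()) (across (λ ()) a21 a12) (across (λ ()) a21 a12)
  lower : ∀ W → WeaklyResolving G W → 2 ≤ length W
  lower []          R = ⊥-elim (R (zero , zero) (suc zero , zero) (λ ()) λ _ ())
  lower (_ ∷ _ ∷ _) _ = s≤s (s≤s z≤n)
  lower (z ∷ [])    R with unresolved-by z
  ... | u , v , u≢v , same = ⊥-elim (R u v u≢v λ { _ (here refl) → same })

-- Orders n ≥ 4

suc[t+[n∸t∸1]]≡n : ∀ {t n} → t < n → suc (t + (n ∸ t ∸ 1)) ≡ n
suc[t+[n∸t∸1]]≡n {zero}  {suc n} _         = refl
suc[t+[n∸t∸1]]≡n {suc t} {suc n} (s≤s t<n) = cong suc (suc[t+[n∸t∸1]]≡n t<n)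

0<n∸t∸1 : ∀ {t n} → suc t < n → 0 < n ∸ t ∸ 1
0<n∸t∸1 {zero}  {suc (suc n)} _            = z<s
0<n∸t∸1 {zero}  {suc zero}    (s≤s ())
0<n∸t∸1 {suc t} {suc n}       (s≤s 1+t<n) = 0<n∸t∸1 1+t<n

module _ (n t : ℕ) .{{_ : NonZero t}} (1+t<n : suc t < n) where

  private
    instance
      n∸t∸1≢0 : NonZero (n ∸ t ∸ 1)
      n∸t∸1≢0 = >-nonZero (0<n∸t∸1 1+t<n)

    dimension≡ : t + (n ∸ t ∸ 1) ∸ 1 ≡ n ∸ 2
    dimension≡ = cong (_∸ 2) (suc[t+[n∸t∸1]]≡n (<-trans (n<1+n t) 1+t<n))

  weakMetricDim-G1[K1,Kt,Kn∸t∸1] : WeakMetricDim G1[ K 1 , K t , K (n ∸ t ∸ 1) ] (n ∸ 2)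
  weakMetricDim-G1[K1,Kt,Kn∸t∸1] = subst (WeakMetricDim _) dimension≡
    (weakMetricDim-K1-Kt-Ks {A = G1Arc} a01 a12 a21 (λ ()) t _)

  weakMetricDim-G2[K1,Kt,Kn∸t∸1] : WeakMetricDim G2[ K 1 , K t , K (n ∸ t ∸ 1) ] (n ∸ 2)
  weakMetricDim-G2[K1,Kt,Kn∸t∸1] = subst (WeakMetricDim _) dimension≡
    (weakMetricDim-K1-Kt-Ks {A = G2Arc} a01 a12 a21 (λ ()) t _)

  weakMetricDim-G2[Kt,Kn∸t∸1,K1] : WeakMetricDim G2[ K t , K (n ∸ t ∸ 1) , K 1 ] (n ∸ 2)
  weakMetricDim-G2[Kt,Kn∸t∸1,K1] = subst (WeakMetricDim _) dimension≡
    (weakMetricDim-G2[Kt,Ks,K1] t _)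

lemma4p4 :
    WeakMetricDim G2[ K 1 , P2 , K 1 ] 2
    × (∀ (n t : ℕ) → 4 ≤ n → 1 ≤ t → t ≤ n ∸ 2 →
         WeakMetricDim G1[ K 1 , K t , K (n ∸ t ∸ 1) ] (n ∸ 2)
         × WeakMetricDim G2[ K 1 , K t , K (n ∸ t ∸ 1) ] (n ∸ 2)
         × WeakMetricDim G2[ K t , K (n ∸ t ∸ 1) , K 1 ] (n ∸ 2)
         × WeakMetricDim G2[ K 1 , Kbar (n ∸ 2) , K 1 ] (n ∸ 2))
lemma4p4 = weakMetricDim-G2[K1,P2,K1] , λ where
  n t (s≤s (s≤s (s≤s (s≤s _)))) (s≤s _) t≤n∸2 →
    let 1+t<n = s≤s (s≤s t≤n∸2) in
      weakMetricDim-G1[K1,Kt,Kn∸t∸1] n t 1+t<n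
    , weakMetricDim-G2[K1,Kt,Kn∸t∸1] n t 1+t<n
    , weakMetricDim-G2[Kt,Kn∸t∸1,K1] n t 1+t<n
    , weakMetricDim-G2[K1,Kbar,K1] (n ∸ 2)
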